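{- For each integer $\ell\ge 1$, there are infinitely many integers $b\ge 2$ such that there exist a positive integer $y$ and a word $w$ over $\{0,1,\dots,b-1\}$ with $|w|=\ell$ and $(y^2)_b = w\uparrow 2$.
   Context: $(m)_b$ denotes the canonical base-$b$ representation of the integer $m$ (no leading zeros); $|w|$ is the length of the word $w$ and $w\uparrow n$ is the concatenation of $n$ copies of $w$. -}

module Defs where

open import Data.Nat using (ℕ; zero; suc; _+_; _*_; _/_; _%_; NonZero)
open import Data.List using (List; []; _∷_; _++_; concat; replicate)

-- Little-endian digit list of m in base b, with fuel (fuel ≥ m suffices for b ≥ 2).
digitsLE : (fuel b m : ℕ) → .{{NonZero b}} → List ℕ
digitsLE zero    b m = []
digitsLE (suc f) b zero = []
digitsLE (suc f) b (suc m) = (suc m % b) ∷ digitsLE f b (suc m / b)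

-- (m)_b : canonical base-b representation, most significant digit first,
-- no leading zeros (so (0)_b is the empty word).
open import Data.List using (reverse)
repr : (b m : ℕ) → .{{NonZero b}} → List ℕ
repr b m = reverse (digitsLE m b m)

_↑_ : {A : Set} → List A → ℕ → List A
w ↑ n = concat (replicate n w)

{-# OPTIONS --safe #-}
module Submission where

-- If x has exactly ℓ base-b digits, then x * (b^ℓ + 1) is written (x)_b (x)_b, so it suffices to make
-- x * (b^ℓ + 1) a square. Put K = ℓ^ℓ + 1 and b = ℓ + K (1 + K T). Modulo K², the binomial expansion gives
-- b^ℓ ≡ ℓ^ℓ + ℓ^ℓ K (1 + K T) ≡ ℓ^ℓ (1 + K) ≡ (K - 1)(K + 1) ≡ -1, so b^ℓ + 1 = K² M, and
-- y = M K ℓ^ℓ has y² = x (b^ℓ + 1) with x = M (ℓ^ℓ)². Since K ≤ 2 ℓ^ℓ, x ≥ K² M / 4 > b^(ℓ-1),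
-- while x < K² M - 1 = b^ℓ; and b ≥ T is as large as we like.

open import Defs
open import Data.Nat using (ℕ; zero; suc; _+_; _*_; _^_; _%_; _/_; _≤_; _<_; NonZero; >-nonZero; s≤s; z≤n; s≤s⁻¹)
open import Data.Nat.Properties
open import Data.Nat.DivMod
open import Data.Nat.Divisibility using (divides)
open import Data.Nat.Tactic.RingSolver using (solve-∀)
open import Data.List using (List; []; _∷_; _++_; length; reverse)
open import Data.List.Properties using (reverse-++; length-reverse; ++-identityʳ; unfold-reverse)
open import Data.List.Relation.Unary.All using (All; []; _∷_)
open import Data.List.Relation.Unary.All.Properties using (∷ʳ⁺)
open import Data.Product using (_×_; _,_; proj₁; proj₂; Σ-syntax; ∃-syntax)
open import Data.Empty using (⊥-elim)
open import Relation.Binary.PropositionalEquality using (_≡_; refl; sym; trans; cong; cong₂; subst; module ≡-Reasoning)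

All-reverse : {P : ℕ → Set} (xs : List ℕ) → All P xs → All P (reverse xs)
All-reverse []       []         = []
All-reverse (x ∷ xs) (px ∷ pxs) =
  subst (All _) (sym (unfold-reverse x xs)) (∷ʳ⁺ (All-reverse xs pxs) px)

module Digits (b : ℕ) {{_ : NonZero b}} (1<b : 1 < b) where

  lowDigits : ℕ → ℕ → List ℕ
  lowDigits zero    x = []
  lowDigits (suc n) x = x % b ∷ lowDigits n (x / b)

  length-lowDigits : ∀ n x → length (lowDigits n x) ≡ n
  length-lowDigits zero    x = refl
  length-lowDigits (suc n) x = cong suc (length-lowDigits n (x / b))

  lowDigits-< : ∀ n x → All (_< b) (lowDigits n x)
  lowDigits-< zero    x = []
  lowDigits-< (suc n) x = m%n<n x b ∷ lowDigits-< n (x / b)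

  digitsLE-zero : ∀ f → digitsLE f b 0 ≡ []
  digitsLE-zero zero    = refl
  digitsLE-zero (suc f) = refl

  digitsLE-suc : ∀ f m → 1 ≤ m → digitsLE (suc f) b m ≡ m % b ∷ digitsLE f b (m / b)
  digitsLE-suc f (suc m) _ = refl

  m≤1+f⇒m/b≤f : ∀ {m f} → 1 ≤ m → m ≤ suc f → m / b ≤ f
  m≤1+f⇒m/b≤f {m} 1≤m m≤1+f = s≤s⁻¹ (≤-trans (m/n<m m b {{>-nonZero 1≤m}} 1<b) m≤1+f)

  digitsLE-fuel : ∀ f g m → m ≤ f → m ≤ g → digitsLE f b m ≡ digitsLE g b m
  digitsLE-fuel f       g       zero    _  _  = trans (digitsLE-zero f) (sym (digitsLE-zero g))
  digitsLE-fuel (suc f) (suc g) (suc m) ≤1+f ≤1+g =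
    cong (suc m % b ∷_) (digitsLE-fuel f g (suc m / b) (m≤1+f⇒m/b≤f (s≤s z≤n) ≤1+f) (m≤1+f⇒m/b≤f (s≤s z≤n) ≤1+g))

  x+b^n*z>0 : ∀ n x z → 1 ≤ z → 0 < x + b ^ n * z
  x+b^n*z>0 n x z 1≤z = ≤-trans (*-mono-≤ (m^n>0 b n) 1≤z) (m≤n+m _ x)

  digitsLE-++ : ∀ n x z f → x < b ^ n → 1 ≤ z → x + b ^ n * z ≤ f →
                digitsLE f b (x + b ^ n * z) ≡ lowDigits n x ++ digitsLE z b z
  digitsLE-++ zero    (suc x) z f (s≤s ()) _ _
  digitsLE-++ zero    zero    z f _ _ z≤f rewrite +-identityʳ z = digitsLE-fuel f z z z≤f ≤-refl
  digitsLE-++ (suc n) x       z zero _ 1≤z v≤0 =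
    ⊥-elim (<⇒≱ (≤-trans (x+b^n*z>0 (suc n) x z 1≤z) v≤0) z≤n)
  digitsLE-++ (suc n) x       z (suc f) x<b^[1+n] 1≤z v≤1+f = begin
      digitsLE (suc f) b v
    ≡⟨ digitsLE-suc f v 1≤v ⟩
      v % b ∷ digitsLE f b (v / b)
    ≡⟨ cong₂ (λ d q → d ∷ digitsLE f b q) v%b v/b ⟩
      x % b ∷ digitsLE f b (x / b + b ^ n * z)
    ≡⟨ cong (x % b ∷_) (digitsLE-++ n (x / b) z f x/b<b^n 1≤z (subst (_≤ f) v/b (m≤1+f⇒m/b≤f 1≤v v≤1+f))) ⟩
      x % b ∷ lowDigits n (x / b) ++ digitsLE z b z
    ∎
    where
    open ≡-Reasoning
    v = x + b ^ suc n * z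
    1≤v = x+b^n*z>0 (suc n) x z 1≤z
    v≡ : v ≡ x + b ^ n * z * b
    v≡ = cong (x +_) (trans (*-assoc b (b ^ n) z) (*-comm b (b ^ n * z)))
    v%b : v % b ≡ x % b
    v%b = trans (cong (_% b) v≡) ([m+kn]%n≡m%n x (b ^ n * z) b)
    v/b : v / b ≡ x / b + b ^ n * z
    v/b = trans (cong (_/ b) v≡)
                (trans (+-distrib-/-∣ʳ x (divides (b ^ n * z) refl)) (cong (x / b +_) (m*n/n≡m (b ^ n * z) b)))
    x/b<b^n : x / b < b ^ n
    x/b<b^n = m<n*o⇒m/o<n (subst (x <_) (*-comm b (b ^ n)) x<b^[1+n])

  digitsLE-lowDigits : ∀ n x f → b ^ n ≤ x → x < b ^ suc n → x ≤ f → digitsLE f b x ≡ lowDigits (suc n) x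
  digitsLE-lowDigits n       x zero    b^n≤x _ x≤0 = ⊥-elim (<⇒≱ (≤-trans (m^n>0 b n) b^n≤x) x≤0)
  digitsLE-lowDigits zero    x (suc f) 1≤x   x<b _ = begin
      digitsLE (suc f) b x          ≡⟨ digitsLE-suc f x 1≤x ⟩
      x % b ∷ digitsLE f b (x / b)  ≡⟨ cong (λ q → x % b ∷ digitsLE f b q) (m<n⇒m/n≡0 (subst (x <_) (*-identityʳ b) x<b)) ⟩
      x % b ∷ digitsLE f b 0        ≡⟨ cong (x % b ∷_) (digitsLE-zero f) ⟩
      x % b ∷ []                    ∎
    where open ≡-Reasoning
  digitsLE-lowDigits (suc n) x (suc f) b^[1+n]≤x x<b^[2+n] x≤1+f =
    trans (digitsLE-suc f x 1≤x)
          (cong (x % b ∷_) (digitsLE-lowDigits n (x / b) f b^n≤x/b x/b<b^[1+n] (m≤1+f⇒m/b≤f 1≤x x≤1+f)))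
    where
    1≤x = ≤-trans (m^n>0 b (suc n)) b^[1+n]≤x
    b^n≤x/b : b ^ n ≤ x / b
    b^n≤x/b = subst (_≤ x / b) (m*n/n≡m (b ^ n) b) (/-monoˡ-≤ b (subst (_≤ x) (*-comm b (b ^ n)) b^[1+n]≤x))
    x/b<b^[1+n] : x / b < b ^ suc n
    x/b<b^[1+n] = m<n*o⇒m/o<n (subst (x <_) (*-comm b (b ^ suc n)) x<b^[2+n])

  module _ (n x : ℕ) (b^n≤x : b ^ n ≤ x) (x<b^[1+n] : x < b ^ suc n) where

    repr-lowDigits : repr b x ≡ reverse (lowDigits (suc n) x)
    repr-lowDigits = cong reverse (digitsLE-lowDigits n x x b^n≤x x<b^[1+n] ≤-refl)

    length-repr : length (repr b x) ≡ suc n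
    length-repr = trans (cong length repr-lowDigits)
                        (trans (length-reverse (lowDigits (suc n) x)) (length-lowDigits (suc n) x))

    repr-< : All (_< b) (repr b x)
    repr-< = subst (All (_< b)) (sym repr-lowDigits) (All-reverse _ (lowDigits-< (suc n) x))

    repr-*[1+b^[1+n]] : repr b (x * (1 + b ^ suc n)) ≡ repr b x ↑ 2
    repr-*[1+b^[1+n]] = begin
        reverse (digitsLE v b v)
      ≡⟨ cong (λ m → reverse (digitsLE m b m)) v≡u ⟩
        reverse (digitsLE u b u)
      ≡⟨ cong reverse (digitsLE-++ (suc n) x x u x<b^[1+n] 1≤x ≤-refl) ⟩
        reverse (low ++ digitsLE x b x)
      ≡⟨ reverse-++ low (digitsLE x b x) ⟩
        repr b x ++ reverse low
      ≡⟨ cong (repr b x ++_) (trans (sym repr-lowDigits) (sym (++-identityʳ (repr b x)))) ⟩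
        repr b x ++ repr b x ++ []
      ∎
      where
      open ≡-Reasoning
      v = x * (1 + b ^ suc n)
      u = x + b ^ suc n * x
      v≡u : v ≡ u
      v≡u = trans (*-distribˡ-+ x 1 (b ^ suc n)) (cong₂ _+_ (*-identityʳ x) (*-comm x (b ^ suc n)))
      low = lowDigits (suc n) x
      1≤x = ≤-trans (m^n>0 b n) b^n≤x

binomial-mod-square : ∀ u q v n →
  ∃[ E ] (u + q * v) ^ suc n ≡ u ^ suc n + suc n * u ^ n * q * v + q * q * E
binomial-mod-square u q v zero = 0 , base u q v
  where
  base : ∀ u q v → (u + q * v) * 1 ≡ u * 1 + 1 * 1 * q * v + q * q * 0
  base = solve-∀
binomial-mod-square u q v (suc n) with binomial-mod-square u q v n
... | E , eq = u * E + suc n * u ^ n * v * v + q * v * E , trans (cong ((u + q * v) *_) eq) (step u q v (u ^ n) n E)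
  where
  step : ∀ u q v uⁿ n E →
    (u + q * v) * (u * uⁿ + suc n * uⁿ * q * v + q * q * E)
      ≡ u * (u * uⁿ) + suc (suc n) * (u * uⁿ) * q * v + q * q * (u * E + suc n * uⁿ * v * v + q * v * E)
  step = solve-∀

module Construction (l N : ℕ) where

  ℓ T p K b : ℕ
  ℓ = suc l
  T = suc N
  p = ℓ ^ ℓ
  K = suc p
  b = ℓ + K * (1 + K * T)

  E M x y : ℕ
  E = proj₁ (binomial-mod-square ℓ K (1 + K * T) l)
  M = 1 + p * T + E
  x = M * p * p
  y = M * K * p

  1+b^ℓ≡K²M : 1 + b ^ ℓ ≡ K * K * M
  1+b^ℓ≡K²M = trans (cong (1 +_) (proj₂ (binomial-mod-square ℓ K (1 + K * T) l))) (regroup p T E)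
    where
    regroup : ∀ p T E → 1 + (p + p * suc p * (1 + suc p * T) + suc p * suc p * E) ≡ suc p * suc p * (1 + p * T + E)
    regroup = solve-∀

  y²≡x*[1+b^ℓ] : y ^ 2 ≡ x * (1 + b ^ ℓ)
  y²≡x*[1+b^ℓ] = trans (regroup M K p) (cong (x *_) (sym 1+b^ℓ≡K²M))
    where
    regroup : ∀ M K p → M * K * p * (M * K * p * 1) ≡ M * p * p * (K * K * M)
    regroup = solve-∀

  1≤p : 1 ≤ p
  1≤p = m^n>0 ℓ ℓ

  1≤y : 1 ≤ y
  1≤y = *-mono-≤ {1} {M * K} (*-mono-≤ {1} {M} {1} {K} (s≤s z≤n) (s≤s z≤n)) 1≤p

  N≤b : N ≤ b
  N≤b = begin
    N                  ≤⟨ n≤1+n N ⟩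
    T                  ≤⟨ m≤n*m T K ⟩
    K * T              ≤⟨ n≤1+n _ ⟩
    1 + K * T          ≤⟨ m≤n*m _ K ⟩
    K * (1 + K * T)    ≤⟨ m≤n+m _ ℓ ⟩
    b                  ∎
    where open ≤-Reasoning

  4≤b : 4 ≤ b
  4≤b = ≤-trans (*-mono-≤ {2} {K} (s≤s 1≤p) (s≤s (*-mono-≤ {1} {K} {1} {T} (s≤s z≤n) (s≤s z≤n)))) (m≤n+m _ ℓ)

  x<b^ℓ : x < b ^ ℓ
  x<b^ℓ = s≤s⁻¹ (begin
    2 + x                    ≤⟨ +-monoˡ-≤ x 2≤r ⟩
    r + x                    ≡⟨ +-comm r x ⟩
    x + r                    ≡⟨ regroup M p ⟨
    K * K * M                ≡⟨ 1+b^ℓ≡K²M ⟨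
    1 + b ^ ℓ                ∎)
    where
    open ≤-Reasoning
    r = M * (p + p) + M
    2≤r : 2 ≤ r
    2≤r = +-mono-≤ (*-mono-≤ {1} {M} (s≤s z≤n) (≤-trans 1≤p (m≤m+n p p))) (s≤s z≤n)
    regroup : ∀ M p → suc p * suc p * M ≡ M * p * p + (M * (p + p) + M)
    regroup = solve-∀

  b^l≤x : b ^ l ≤ x
  b^l≤x = *-cancelˡ-≤ 4 (begin
    4 * b ^ l                ≤⟨ *-monoˡ-≤ (b ^ l) 4≤b ⟩
    b ^ ℓ                    ≤⟨ n≤1+n _ ⟩
    1 + b ^ ℓ                ≡⟨ 1+b^ℓ≡K²M ⟩
    K * K * M                ≤⟨ *-monoˡ-≤ M (*-mono-≤ K≤2p K≤2p) ⟩
    (p + p) * (p + p) * M    ≡⟨ regroup M p ⟩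
    4 * x                    ∎)
    where
    open ≤-Reasoning
    K≤2p : K ≤ p + p
    K≤2p = +-monoˡ-≤ p 1≤p
    regroup : ∀ M p → (p + p) * (p + p) * M ≡ 4 * (M * p * p)
    regroup = solve-∀

mainTheorem3 : (ℓ : ℕ) → 1 ≤ ℓ → (N : ℕ) →
    Σ[ b ∈ ℕ ] Σ[ b≥2 ∈ 2 ≤ b ] N ≤ b ×
      Σ[ y ∈ ℕ ] 1 ≤ y × Σ[ w ∈ List ℕ ] All (_< b) w × length w ≡ ℓ ×
        repr b (y ^ 2) {{>-nonZero (<-trans (s≤s z≤n) b≥2)}} ≡ w ↑ 2
mainTheorem3 zero    () N
mainTheorem3 (suc l) _  N =
  b , 2≤b , N≤b , y , 1≤y , repr b x , repr-< l x b^l≤x x<b^ℓ , length-repr l x b^l≤x x<b^ℓ ,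
  trans (cong (λ m → repr b m) y²≡x*[1+b^ℓ]) (repr-*[1+b^[1+n]] l x b^l≤x x<b^ℓ)
  where
  open Construction l N
  2≤b : 2 ≤ b
  2≤b = ≤-trans (s≤s (s≤s z≤n)) 4≤b
  instance
    b≢0 : NonZero b
    b≢0 = >-nonZero (<-trans (s≤s z≤n) 2≤b)
  open Digits b 2≤b
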